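{- Let $n$ be a power of $2$ and $f:[n]^d\to\{0,1\}$. If $I^-_f<\sqrt d$, then $I_f<7\sqrt d\log n$.
   Context: The augmented hypergrid $\mathbf{A}_{n,d}$ is the directed graph on $[n]^d$ with an edge $(x,y)$ whenever $x,y$ differ in exactly one coordinate $i$ and $y_i-x_i=2^a$ for some integer $a\ge0$. $S_f$ is the set of edges $(x,y)$ of $\mathbf{A}_{n,d}$ with $f(x)\ne f(y)$ and $S^-_f\subseteq S_f$ those with $f(x)=1,f(y)=0$; $I_f:=|S_f|/n^d$ and $I^-_f:=|S^-_f|/n^d$. $\log$ is base $2$. -}

module Defs where

open import Data.Nat using (ℕ; zero; suc; _+_; _*_; _∸_; _^_; _<ᵇ_; _≡ᵇ_)
open import Data.Bool using (Bool; true; false; _∧_; _∨_; not; _xor_; if_then_else_)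
open import Data.Fin using (Fin; toℕ)
open import Data.Vec using (Vec; []; _∷_)
open import Data.List using (List; []; _∷_; [_]; map; concatMap; allFin; upTo; length; filterᵇ; cartesianProduct)
open import Data.Product using (_×_; _,_)
open import Data.Bool.ListAction using (any)

-- Points of the hypergrid [n]^d, with [n] = {0,…,n-1} represented by Fin n.
Point : ℕ → ℕ → Set
Point n d = Vec (Fin n) d

allPoints : (n d : ℕ) → List (Point n d)
allPoints n zero    = [ [] ]
allPoints n (suc d) = concatMap (λ i → map (i ∷_) (allPoints n d)) (allFin n)

-- m is a power of two, i.e. m = 2^a for some a ≥ 0 (if m = 2^a then a < m).
isPow2 : ℕ → Bool
isPow2 m = any (λ a → (2 ^ a) ≡ᵇ m) (upTo m)

numDiff : ∀ {n d} → Point n d → Point n d → ℕ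
numDiff []       []       = 0
numDiff (a ∷ x)  (b ∷ y)  = (if toℕ a ≡ᵇ toℕ b then 0 else 1) + numDiff x y

coordOK : ∀ {n d} → Point n d → Point n d → Bool
coordOK []      []      = true
coordOK (a ∷ x) (b ∷ y) =
  ((toℕ a ≡ᵇ toℕ b) ∨ ((toℕ a <ᵇ toℕ b) ∧ isPow2 (toℕ b ∸ toℕ a))) ∧ coordOK x y

isEdge : ∀ {n d} → Point n d → Point n d → Bool
isEdge x y = (numDiff x y ≡ᵇ 1) ∧ coordOK x y

allPairs : (n d : ℕ) → List (Point n d × Point n d)
allPairs n d = cartesianProduct (allPoints n d) (allPoints n d)

sizeS : ∀ {n d} → (Point n d → Bool) → ℕ
sizeS {n} {d} f = length (filterᵇ (λ { (x , y) → isEdge x y ∧ (f x xor f y) }) (allPairs n d))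

sizeS⁻ : ∀ {n d} → (Point n d → Bool) → ℕ
sizeS⁻ {n} {d} f = length (filterᵇ (λ { (x , y) → isEdge x y ∧ (f x ∧ not (f y)) }) (allPairs n d))

-- Call an arc x → y of A_{n,d} a descent if f x = 1, f y = 0 and an ascent if
-- f x = 0, f y = 1. Counting the arcs that meet f⁻¹(1) from both ends shows
-- #ascents ≤ #descents + ∑ₓ (indeg x − outdeg x)⁺, so I_f ≤ 2 I⁻_f + ∑ₓ |g x| / n^d
-- with g = indeg − outdeg. In A_{n,d} with n = 2^k, g x = ∑ᵢ h(xᵢ) for the
-- one-dimensional imbalance h of A_n, which sums to 0 and satisfies |h| ≤ k
-- (at most k powers of two in either direction). Hence ∑ₓ g(x)² = d n^(d-1) ∑ₜ h(t)²
-- ≤ d n^d k², and Cauchy–Schwarz gives ∑ₓ |g x| ≤ √d n^d k, i.e. I_f ≤ 2 I⁻_f + √d log n.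

module Submission where

open import Defs
open import Level using (Level)
open import Algebra.Bundles using (Semiring)
open import Data.List using (List; []; _∷_; _++_; map; concatMap; cartesianProduct; allFin; length)
open import Data.List.Properties using (length-++; length-map; length-tabulate)
import Data.Nat as ℕ
open import Data.Nat using (ℕ; zero; suc)
open import Data.Product using (_×_; _,_; ∃-syntax)
open import Data.Fin using (Fin; toℕ) renaming (zero to fzero; suc to fsuc)
open import Data.Vec using ([]; _∷_; toList)
open import Function using (id; _∘_; _$_)
open import Relation.Binary.PropositionalEquality as ≡ using (_≡_)

private
  variable
    a b : Level
    A : Set a
    B : Set b

module Sum {c ℓ} (R : Semiring c ℓ) where

  open Semiring R
  open import Algebra.Properties.CommutativeSemigroup +-commutativeSemigroup using (interchange)
  open import Relation.Binary.Reasoning.Setoid setoid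

  ∑ : List A → (A → Carrier) → Carrier
  ∑ []       f = 0#
  ∑ (x ∷ xs) f = f x + ∑ xs f

  infixl 10 ∑
  syntax ∑ xs (λ x → e) = ∑[ x ∈ xs ] e

  ∑-cong : ∀ (xs : List A) {f g : A → Carrier} → (∀ x → f x ≈ g x) → ∑ xs f ≈ ∑ xs g
  ∑-cong []       f≈g = refl
  ∑-cong (x ∷ xs) f≈g = +-cong (f≈g x) (∑-cong xs f≈g)

  ∑-++ : ∀ (xs ys : List A) f → ∑ (xs ++ ys) f ≈ ∑ xs f + ∑ ys f
  ∑-++ []       ys f = sym (+-identityˡ _)
  ∑-++ (x ∷ xs) ys f = trans (+-congˡ (∑-++ xs ys f)) (sym (+-assoc _ _ _))

  ∑-zero : ∀ (xs : List A) → ∑[ x ∈ xs ] 0# ≈ 0#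
  ∑-zero []       = refl
  ∑-zero (x ∷ xs) = trans (+-identityˡ _) (∑-zero xs)

  ∑-distrib-+ : ∀ (xs : List A) f g → ∑[ x ∈ xs ] (f x + g x) ≈ ∑ xs f + ∑ xs g
  ∑-distrib-+ []       f g = sym (+-identityˡ _)
  ∑-distrib-+ (x ∷ xs) f g =
    trans (+-congˡ (∑-distrib-+ xs f g)) (interchange _ _ _ _)

  *-distribˡ-∑ : ∀ c (xs : List A) f → c * ∑ xs f ≈ ∑[ x ∈ xs ] (c * f x)
  *-distribˡ-∑ c []       f = zeroʳ c
  *-distribˡ-∑ c (x ∷ xs) f = trans (distribˡ c _ _) (+-congˡ (*-distribˡ-∑ c xs f))

  *-distribʳ-∑ : ∀ c (xs : List A) f → ∑ xs f * c ≈ ∑[ x ∈ xs ] (f x * c)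
  *-distribʳ-∑ c []       f = zeroˡ c
  *-distribʳ-∑ c (x ∷ xs) f = trans (distribʳ c _ _) (+-congˡ (*-distribʳ-∑ c xs f))

  ∑-comm : (xs : List A) (ys : List B) (f : A → B → Carrier) →
           ∑[ x ∈ xs ] ∑[ y ∈ ys ] f x y ≈ ∑[ y ∈ ys ] ∑[ x ∈ xs ] f x y
  ∑-comm []       ys f = sym (∑-zero ys)
  ∑-comm (x ∷ xs) ys f =
    trans (+-congˡ (∑-comm xs ys f)) (sym (∑-distrib-+ ys (f x) _))

  ∑-map : (g : A → B) (xs : List A) (f : B → Carrier) → ∑ (map g xs) f ≡ ∑ xs (f ∘ g)
  ∑-map g []       f = ≡.refl
  ∑-map g (x ∷ xs) f = ≡.cong (f (g x) +_) (∑-map g xs f)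

  ∑-concatMap : (g : A → List B) (xs : List A) (f : B → Carrier) →
                ∑ (concatMap g xs) f ≈ ∑[ x ∈ xs ] ∑ (g x) f
  ∑-concatMap g []       f = refl
  ∑-concatMap g (x ∷ xs) f =
    trans (∑-++ (g x) (concatMap g xs) f) (+-congˡ (∑-concatMap g xs f))

  ∑-cartesianProduct : (xs : List A) (ys : List B) (f : A × B → Carrier) →
    ∑ (cartesianProduct xs ys) f ≈ ∑[ x ∈ xs ] ∑[ y ∈ ys ] f (x , y)
  ∑-cartesianProduct []       ys f = refl
  ∑-cartesianProduct (x ∷ xs) ys f = begin
    ∑ (map (x ,_) ys ++ cartesianProduct xs ys) f              ≈⟨ ∑-++ (map (x ,_) ys) _ f ⟩
    ∑ (map (x ,_) ys) f + ∑ (cartesianProduct xs ys) f         ≈⟨ +-cong (reflexive (∑-map (x ,_) ys f)) (∑-cartesianProduct xs ys f) ⟩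
    ∑[ y ∈ ys ] f (x , y) + ∑[ x ∈ xs ] ∑[ y ∈ ys ] f (x , y)  ∎

  ∑-allPoints-suc : ∀ n d (f : Point n (suc d) → Carrier) →
    ∑ (allPoints n (suc d)) f ≈ ∑[ s ∈ allFin n ] ∑[ x ∈ allPoints n d ] f (s ∷ x)
  ∑-allPoints-suc n d f = trans (∑-concatMap (λ s → map (s ∷_) (allPoints n d)) (allFin n) f)
    (∑-cong (allFin n) (λ s → reflexive (∑-map (s ∷_) (allPoints n d) f)))

open import Data.Integer as ℤ using (ℤ)
import Data.Integer.Properties as ℤ

length-concatMap-const : ∀ {m} (g : A → List B) xs → (∀ x → length (g x) ≡ m) → length (concatMap g xs) ≡ length xs ℕ.* m
length-concatMap-const g []       len-g = ≡.refl
length-concatMap-const g (x ∷ xs) len-g =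
  ≡.trans (length-++ (g x)) (≡.cong₂ ℕ._+_ (len-g x) (length-concatMap-const g xs len-g))

length-allPoints : ∀ n d → length (allPoints n d) ≡ n ℕ.^ d
length-allPoints n zero    = ≡.refl
length-allPoints n (suc d) =
  ≡.trans (length-concatMap-const (λ s → map (s ∷_) (allPoints n d)) (allFin n)
             (λ s → ≡.trans (length-map (s ∷_) (allPoints n d)) (length-allPoints n d)))
          (≡.cong (λ m → m ℕ.* n ℕ.^ d) (length-tabulate {n = n} id))

module ℤSum = Sum ℤ.+-*-semiring

module Variance where

  open import Data.Integer using (+_; 0ℤ; 1ℤ; _+_; _*_)
  open import Data.Integer.Properties
  open import Data.Integer.Tactic.RingSolver using (solve-∀)
  open import Relation.Binary.PropositionalEquality
  open ℤSum

  ∑-const : ∀ (xs : List A) c → ∑[ x ∈ xs ] c ≡ + length xs * c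
  ∑-const []       c = sym (*-zeroˡ c)
  ∑-const (x ∷ xs) c = begin
    c + ∑[ x ∈ xs ] c          ≡⟨ cong (_+_ c) (∑-const xs c) ⟩
    c + + length xs * c        ≡⟨ cong (_+ + length xs * c) (*-identityˡ c) ⟨
    1ℤ * c + + length xs * c   ≡⟨ *-distribʳ-+ c 1ℤ (+ length xs) ⟨
    + suc (length xs) * c      ∎
    where open ≡-Reasoning

  ∑-allPoints-const : ∀ n d c → ∑[ x ∈ allPoints n d ] c ≡ + (n ℕ.^ d) * c
  ∑-allPoints-const n d c = trans (∑-const (allPoints n d) c) (cong (λ m → + m * c) (length-allPoints n d))

  coordSum : ∀ {n d} → (Fin n → ℤ) → Point n d → ℤ
  coordSum h x = ∑[ t ∈ toList x ] h t

  -- coordSum is a sum of d independent copies of a mean-zero h, so its second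
  -- moment is d times that of h: the cross terms vanish because ∑ h = 0.
  module _ {n : ℕ} (h : Fin n → ℤ) (∑h≡0 : ∑[ t ∈ allFin n ] h t ≡ 0ℤ) where

    ∑-coordSum²-suc : ∀ d →
      ∑[ x ∈ allPoints n (suc d) ] (coordSum h x * coordSum h x)
        ≡ + (n ℕ.^ d) * ∑[ t ∈ allFin n ] (h t * h t) + + n * ∑[ x ∈ allPoints n d ] (coordSum h x * coordSum h x)
    ∑-coordSum²-suc d = begin
      ∑[ x ∈ allPoints n (suc d) ] (coordSum h x * coordSum h x)
        ≡⟨ ∑-allPoints-suc n d _ ⟩
      ∑[ t ∈ fins ] ∑[ x ∈ pts ] ((h t + G x) * (h t + G x))
        ≡⟨ ∑-cong fins (λ t → ∑-cong pts (λ x → square-+ (h t) (G x))) ⟩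
      ∑[ t ∈ fins ] ∑[ x ∈ pts ] (h t * h t + + 2 * h t * G x + G x * G x)
        ≡⟨ ∑-cong fins (λ t → trans (∑-distrib-+ pts _ _) (cong (_+ Q) (∑-distrib-+ pts _ _))) ⟩
      ∑[ t ∈ fins ] (∑[ x ∈ pts ] (h t * h t) + ∑[ x ∈ pts ] (+ 2 * h t * G x) + Q)
        ≡⟨ ∑-cong fins (λ t → cong₂ (λ u v → u + v + Q) (sym (∑-allPoints-const n d (h t * h t))) (*-distribˡ-∑ (+ 2 * h t) pts G)) ⟨
      ∑[ t ∈ fins ] (+ (n ℕ.^ d) * (h t * h t) + + 2 * h t * ∑ pts G + Q)
        ≡⟨ trans (∑-distrib-+ fins _ (λ _ → Q)) (cong (_+ ∑[ t ∈ fins ] Q) (∑-distrib-+ fins _ _)) ⟩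
      ∑[ t ∈ fins ] (+ (n ℕ.^ d) * (h t * h t)) + ∑[ t ∈ fins ] (+ 2 * h t * ∑ pts G) + ∑[ t ∈ fins ] Q
        ≡⟨ cong₂ _+_ (cong₂ _+_ (sym (*-distribˡ-∑ (+ (n ℕ.^ d)) fins _)) cross-terms) (∑-const fins Q) ⟩
      + (n ℕ.^ d) * H + 0ℤ + + length fins * Q
        ≡⟨ cong₂ _+_ (+-identityʳ (+ (n ℕ.^ d) * H)) (cong (λ m → + m * Q) (length-tabulate {n = n} id)) ⟩
      + (n ℕ.^ d) * H + + n * Q
        ∎
      where
      open ≡-Reasoning
      fins = allFin n
      pts  = allPoints n d
      G : Point n d → ℤ
      G = coordSum h
      Q = ∑[ x ∈ pts ] (G x * G x)
      H = ∑[ t ∈ fins ] (h t * h t)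
      square-+ : ∀ a g → (a + g) * (a + g) ≡ a * a + + 2 * a * g + g * g
      square-+ = solve-∀
      cross-terms : ∑[ t ∈ fins ] (+ 2 * h t * ∑ pts G) ≡ 0ℤ
      cross-terms = begin
        ∑[ t ∈ fins ] (+ 2 * h t * ∑ pts G)   ≡⟨ *-distribʳ-∑ (∑ pts G) fins _ ⟨
        ∑[ t ∈ fins ] (+ 2 * h t) * ∑ pts G   ≡⟨ cong (_* ∑ pts G) (*-distribˡ-∑ (+ 2) fins h) ⟨
        + 2 * ∑ fins h * ∑ pts G              ≡⟨ cong (λ s → + 2 * s * ∑ pts G) ∑h≡0 ⟩
        + 2 * 0ℤ * ∑ pts G                    ≡⟨ *-zeroˡ (∑ pts G) ⟩
        0ℤ                                    ∎

    ∑-coordSum² : ∀ d →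
      + n * ∑[ x ∈ allPoints n d ] (coordSum h x * coordSum h x) ≡ + d * + (n ℕ.^ d) * ∑[ t ∈ allFin n ] (h t * h t)
    ∑-coordSum² zero    = trans (*-zeroʳ (+ n)) (sym (*-zeroˡ (∑[ t ∈ allFin n ] (h t * h t))))
    ∑-coordSum² (suc d) = begin
      + n * Q (suc d)                                  ≡⟨ cong (+ n *_) (∑-coordSum²-suc d) ⟩
      + n * (P * H + + n * Q d)                        ≡⟨ cong (λ q → + n * (P * H + q)) (∑-coordSum² d) ⟩
      + n * (P * H + + d * P * H)                      ≡⟨ regroup (+ n) P (+ d) H ⟩
      (1ℤ + + d) * (+ n * P) * H                       ≡⟨ cong (λ p → + suc d * p * H) (pos-* n (n ℕ.^ d)) ⟨
      + suc d * + (n ℕ.^ suc d) * H                    ∎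
      where
      open ≡-Reasoning
      P = + (n ℕ.^ d)
      H = ∑[ t ∈ allFin n ] (h t * h t)
      Q : ℕ → ℤ
      Q d = ∑[ x ∈ allPoints n d ] (coordSum h x * coordSum h x)
      regroup : ∀ m p e s → m * (p * s + e * p * s) ≡ (1ℤ + e) * (m * p) * s
      regroup = solve-∀

open import Data.Bool using (Bool; true; false; T; _∧_; not; _xor_)
open import Data.Bool.Properties using (T-∧; ∧-assoc; ∧-comm)
open import Data.List using (filterᵇ; upTo)
open import Data.List.Membership.Propositional using (_∈_)
open import Data.List.Membership.Propositional.Properties using (∈-upTo⁺)
open import Data.List.Properties using (map-tabulate; length-upTo)
open import Data.List.Relation.Unary.Any using (here; there; satisfied)
open import Data.List.Relation.Unary.Any.Properties using (any⁻)
open import Data.Nat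
open import Data.Nat.Properties
open import Data.Nat.Tactic.RingSolver using (solve-∀)
import Data.Integer.Tactic.RingSolver as ℤRing
open import Data.Fin.Properties using (toℕ<n)
open import Data.Sum using (inj₁; inj₂)
open import Function.Bundles using (Equivalence)
open import Relation.Binary.PropositionalEquality

open Sum +-*-semiring

𝟙 : Bool → ℕ
𝟙 true  = 1
𝟙 false = 0

𝟙-∧ : ∀ a b → 𝟙 (a ∧ b) ≡ 𝟙 a * 𝟙 b
𝟙-∧ false b = refl
𝟙-∧ true  b = sym (+-identityʳ (𝟙 b))

𝟙-≤ : ∀ {b m} → (T b → 1 ≤ m) → 𝟙 b ≤ m
𝟙-≤ {false} _   = z≤n
𝟙-≤ {true}  1≤m = 1≤m _

∑-mono-≤ : ∀ (xs : List A) {f g : A → ℕ} → (∀ x → f x ≤ g x) → ∑ xs f ≤ ∑ xs g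
∑-mono-≤ []       f≤g = z≤n
∑-mono-≤ (x ∷ xs) f≤g = +-mono-≤ (f≤g x) (∑-mono-≤ xs f≤g)

∑-const : ∀ (xs : List A) c → ∑[ x ∈ xs ] c ≡ length xs * c
∑-const []       c = refl
∑-const (x ∷ xs) c = cong (c +_) (∑-const xs c)

∈⇒≤∑ : ∀ {xs : List A} {x} (f : A → ℕ) → x ∈ xs → f x ≤ ∑ xs f
∈⇒≤∑ f (here refl) = m≤m+n _ _
∈⇒≤∑ f (there x∈xs) = ≤-trans (∈⇒≤∑ f x∈xs) (m≤n+m _ _)

length-filterᵇ : ∀ (p : A → Bool) xs → length (filterᵇ p xs) ≡ ∑[ x ∈ xs ] 𝟙 (p x)
length-filterᵇ p []       = refl
length-filterᵇ p (x ∷ xs) with p x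
... | true  = cong suc (length-filterᵇ p xs)
... | false = length-filterᵇ p xs

2mn≤m²+n² : ∀ m n → 2 * (m * n) ≤ m * m + n * n
2mn≤m²+n² m n with ≤-total m n
... | inj₁ m≤n = subst (λ n → 2 * (m * n) ≤ m * m + n * n) (m+[n∸m]≡n m≤n)
                   (≤-trans (m≤m+n _ _) (≤-reflexive (expand m (n ∸ m))))
  where expand : ∀ m c → 2 * (m * (m + c)) + c * c ≡ m * m + (m + c) * (m + c)
        expand = solve-∀
... | inj₂ n≤m = subst (λ m → 2 * (m * n) ≤ m * m + n * n) (m+[n∸m]≡n n≤m)
                   (≤-trans (m≤m+n _ _) (≤-reflexive (expand n (m ∸ n))))
  where expand : ∀ n c → 2 * ((n + c) * n) + c * c ≡ (n + c) * (n + c) + n * n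
        expand = solve-∀

cauchy-schwarz : ∀ (xs : List A) f → ∑ xs f * ∑ xs f ≤ length xs * ∑[ x ∈ xs ] (f x * f x)
cauchy-schwarz xs f = *-cancelˡ-≤ 2 $ begin
  2 * (∑ xs f * ∑ xs f)                                    ≡⟨ cong (2 *_) (double-sum xs f) ⟩
  2 * ∑[ x ∈ xs ] ∑[ y ∈ xs ] (f x * f y)                  ≡⟨ *-distribˡ-∑ 2 xs _ ⟩
  ∑[ x ∈ xs ] (2 * ∑[ y ∈ xs ] (f x * f y))                ≡⟨ ∑-cong xs (λ x → *-distribˡ-∑ 2 xs _) ⟩
  ∑[ x ∈ xs ] ∑[ y ∈ xs ] (2 * (f x * f y))                ≤⟨ ∑-mono-≤ xs (λ x → ∑-mono-≤ xs (λ y → 2mn≤m²+n² (f x) (f y))) ⟩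
  ∑[ x ∈ xs ] ∑[ y ∈ xs ] (f x * f x + f y * f y)          ≡⟨ ∑-cong xs (λ x → ∑-distrib-+ xs _ _) ⟩
  ∑[ x ∈ xs ] (∑[ y ∈ xs ] (f x * f x) + Q)                ≡⟨ ∑-cong xs (λ x → cong (_+ Q) (∑-const xs _)) ⟩
  ∑[ x ∈ xs ] (length xs * (f x * f x) + Q)                ≡⟨ ∑-distrib-+ xs _ _ ⟩
  ∑[ x ∈ xs ] (length xs * (f x * f x)) + ∑[ x ∈ xs ] Q    ≡⟨ cong₂ _+_ (sym (*-distribˡ-∑ (length xs) xs _)) (∑-const xs Q) ⟩
  length xs * Q + length xs * Q                            ≡⟨ cong (length xs * Q +_) (+-identityʳ _) ⟨
  2 * (length xs * Q)                                      ∎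
  where
  open ≤-Reasoning
  Q = ∑[ x ∈ xs ] (f x * f x)
  double-sum : ∀ (xs : List A) f → ∑ xs f * ∑ xs f ≡ ∑[ x ∈ xs ] ∑[ y ∈ xs ] (f x * f y)
  double-sum xs f = trans (*-distribʳ-∑ _ xs f) (∑-cong xs (λ x → *-distribˡ-∑ (f x) xs f))

module Digraph (V : List A) (E : A → A → Bool) where

  outDeg inDeg : A → ℕ
  outDeg x = ∑[ y ∈ V ] 𝟙 (E x y)
  inDeg  y = ∑[ x ∈ V ] 𝟙 (E x y)

  arcsWhere : (A → A → Bool) → ℕ
  arcsWhere P = ∑[ x ∈ V ] ∑[ y ∈ V ] 𝟙 (E x y ∧ P x y)

  excess : ℕ
  excess = ∑[ x ∈ V ] (inDeg x ∸ outDeg x)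

  ∑-inDeg≡∑-outDeg : ∑ V inDeg ≡ ∑ V outDeg
  ∑-inDeg≡∑-outDeg = ∑-comm V V (λ y x → 𝟙 (E x y))

  arcsWhere-+ : (P Q : A → A → Bool) → arcsWhere P + arcsWhere Q ≡ ∑[ x ∈ V ] ∑[ y ∈ V ] (𝟙 (E x y ∧ P x y) + 𝟙 (E x y ∧ Q x y))
  arcsWhere-+ P Q = sym $ trans (∑-cong V (λ x → ∑-distrib-+ V _ _)) (∑-distrib-+ V _ _)

  arcsWhere-source : (f : A → Bool) → arcsWhere (λ x _ → f x) ≡ ∑[ x ∈ V ] (outDeg x * 𝟙 (f x))
  arcsWhere-source f = ∑-cong V λ x →
    trans (∑-cong V (λ y → 𝟙-∧ (E x y) (f x))) (sym (*-distribʳ-∑ (𝟙 (f x)) V (𝟙 ∘ E x)))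

  arcsWhere-target : (f : A → Bool) → arcsWhere (λ _ y → f y) ≡ ∑[ y ∈ V ] (inDeg y * 𝟙 (f y))
  arcsWhere-target f = trans (∑-comm V V _)
    (∑-cong V λ y → trans (∑-cong V (λ x → 𝟙-∧ (E x y) (f y))) (sym (*-distribʳ-∑ (𝟙 (f y)) V (λ x → 𝟙 (E x y)))))

  module _ (f : A → Bool) where

    cut descents ascents : ℕ
    cut      = arcsWhere (λ x y → f x xor f y)
    descents = arcsWhere (λ x y → f x ∧ not (f y))
    ascents  = arcsWhere (λ x y → not (f x) ∧ f y)

    cut≡descents+ascents : cut ≡ descents + ascents
    cut≡descents+ascents = trans (∑-cong V λ x → ∑-cong V λ y → split (E x y) (f x) (f y))
                                 (sym (arcsWhere-+ _ _))
      where
      split : ∀ e a b → 𝟙 (e ∧ (a xor b)) ≡ 𝟙 (e ∧ (a ∧ not b)) + 𝟙 (e ∧ (not a ∧ b))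
      split false a     b     = refl
      split true  false b     = refl
      split true  true  false = refl
      split true  true  true  = refl

    -- Both sides count the arcs x → y with f x ∨ f y.
    ascents+source≡descents+target :
      ascents + arcsWhere (λ x _ → f x) ≡ descents + arcsWhere (λ _ y → f y)
    ascents+source≡descents+target =
      trans (arcsWhere-+ _ _) $
      trans (∑-cong V λ x → ∑-cong V λ y → exchange (E x y) (f x) (f y))
            (sym (arcsWhere-+ _ _))
      where
      exchange : ∀ e a b → 𝟙 (e ∧ (not a ∧ b)) + 𝟙 (e ∧ a) ≡ 𝟙 (e ∧ (a ∧ not b)) + 𝟙 (e ∧ b)
      exchange false a     b     = refl
      exchange true  false false = refl
      exchange true  false true  = refl
      exchange true  true  false = refl
      exchange true  true  true  = refl

    ascents≤descents+excess : ascents ≤ descents + excess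
    ascents≤descents+excess = +-cancelʳ-≤ source ascents _ $ begin
      ascents + source                                                      ≡⟨ ascents+source≡descents+target ⟩
      descents + arcsWhere (λ _ y → f y)                                    ≡⟨ cong (descents +_) (arcsWhere-target f) ⟩
      descents + ∑[ x ∈ V ] (inDeg x * 𝟙 (f x))                             ≤⟨ +-monoʳ-≤ descents (∑-mono-≤ V λ x → bound (f x) (inDeg x) (outDeg x)) ⟩
      descents + ∑[ x ∈ V ] (outDeg x * 𝟙 (f x) + (inDeg x ∸ outDeg x))     ≡⟨ cong (descents +_) (∑-distrib-+ V _ _) ⟩
      descents + (∑[ x ∈ V ] (outDeg x * 𝟙 (f x)) + excess)                 ≡⟨ cong (λ s → descents + (s + excess)) (arcsWhere-source f) ⟨
      descents + (source + excess)                                          ≡⟨ cong (descents +_) (+-comm source excess) ⟩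
      descents + (excess + source)                                          ≡⟨ +-assoc descents excess source ⟨
      descents + excess + source                                            ∎
      where
      open ≤-Reasoning
      source = arcsWhere (λ x _ → f x)
      bound : ∀ b m n → m * 𝟙 b ≤ n * 𝟙 b + (m ∸ n)
      bound false m n = subst (_≤ n * 0 + (m ∸ n)) (sym (*-zeroʳ m)) z≤n
      bound true  m n = subst₂ (λ u v → u ≤ v + (m ∸ n)) (sym (*-identityʳ m)) (sym (*-identityʳ n)) (m≤n+m∸n m n)

    cut≤2*descents+excess : cut ≤ 2 * descents + excess
    cut≤2*descents+excess = begin
      cut                                              ≡⟨ cut≡descents+ascents ⟩
      descents + ascents                               ≤⟨ +-monoʳ-≤ descents ascents≤descents+excess ⟩
      descents + (descents + excess)                   ≡⟨ +-assoc descents descents excess ⟨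
      descents + descents + excess                     ≡⟨ cong (λ m → descents + m + excess) (+-identityʳ descents) ⟨
      2 * descents + excess                            ∎
      where open ≤-Reasoning

open Digraph using (outDeg; inDeg; excess; cut; descents; cut≤2*descents+excess)

sizeS≡cut : ∀ {n d} (f : Point n d → Bool) → sizeS f ≡ cut (allPoints n d) isEdge f
sizeS≡cut {n} {d} f = trans (length-filterᵇ _ (allPairs n d)) (∑-cartesianProduct (allPoints n d) (allPoints n d) _)

sizeS⁻≡descents : ∀ {n d} (f : Point n d → Bool) → sizeS⁻ f ≡ descents (allPoints n d) isEdge f
sizeS⁻≡descents {n} {d} f = trans (length-filterᵇ _ (allPairs n d)) (∑-cartesianProduct (allPoints n d) (allPoints n d) _)

≡ᵇ-comm : ∀ m n → (m ≡ᵇ n) ≡ (n ≡ᵇ m)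
≡ᵇ-comm zero    zero    = refl
≡ᵇ-comm zero    (suc n) = refl
≡ᵇ-comm (suc m) zero    = refl
≡ᵇ-comm (suc m) (suc n) = ≡ᵇ-comm m n

<ᵇ-irrefl : ∀ m → (m <ᵇ m) ≡ false
<ᵇ-irrefl zero    = refl
<ᵇ-irrefl (suc m) = <ᵇ-irrefl m

T⇒1≤𝟙 : ∀ {b} → T b → 1 ≤ 𝟙 b
T⇒1≤𝟙 {true} _ = ≤-refl

isPow2-sound : ∀ m → T (isPow2 m) → ∃[ j ] 2 ^ j ≡ m
isPow2-sound m pow with satisfied (any⁻ (λ a → 2 ^ a ≡ᵇ m) (upTo m) pow)
... | j , 2^j≡m = j , ≡ᵇ⇒≡ _ _ 2^j≡m

∑-allFin-suc : ∀ n (f : Fin (suc n) → ℕ) → ∑ (allFin (suc n)) f ≡ f fzero + ∑[ s ∈ allFin n ] f (fsuc s)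
∑-allFin-suc n f = cong (f fzero +_) $
  trans (cong (λ ss → ∑ ss f) (sym (map-tabulate id fsuc))) (∑-map fsuc (allFin n) f)

∑-𝟙-≡ᵇ≤1 : ∀ n r → ∑[ s ∈ allFin n ] 𝟙 (toℕ s ≡ᵇ r) ≤ 1
∑-𝟙-≡ᵇ≤1 zero    r       = z≤n
∑-𝟙-≡ᵇ≤1 (suc n) zero    = ≤-reflexive (trans (∑-allFin-suc n (λ s → 𝟙 (toℕ s ≡ᵇ 0))) (cong suc (∑-zero (allFin n))))
∑-𝟙-≡ᵇ≤1 (suc n) (suc r) = ≤-trans (≤-reflexive (∑-allFin-suc n (λ s → 𝟙 (toℕ s ≡ᵇ suc r)))) (∑-𝟙-≡ᵇ≤1 n r)

∑-𝟙-≡ᵇ-toℕ : ∀ {n} (t : Fin n) → ∑[ s ∈ allFin n ] 𝟙 (toℕ s ≡ᵇ toℕ t) ≡ 1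
∑-𝟙-≡ᵇ-toℕ {suc n} fzero    = trans (∑-allFin-suc n (λ s → 𝟙 (toℕ s ≡ᵇ 0))) (cong suc (∑-zero (allFin n)))
∑-𝟙-≡ᵇ-toℕ {suc n} (fsuc t) = trans (∑-allFin-suc n (λ s → 𝟙 (toℕ s ≡ᵇ suc (toℕ t)))) (∑-𝟙-≡ᵇ-toℕ t)

∑-𝟙-≡ᵇ-* : ∀ {n} (t : Fin n) c → ∑[ s ∈ allFin n ] (𝟙 (toℕ s ≡ᵇ toℕ t) * c) ≡ c
∑-𝟙-≡ᵇ-* {n} t c = begin
  ∑[ s ∈ allFin n ] (𝟙 (toℕ s ≡ᵇ toℕ t) * c)  ≡⟨ *-distribʳ-∑ c (allFin n) _ ⟨
  ∑[ s ∈ allFin n ] 𝟙 (toℕ s ≡ᵇ toℕ t) * c    ≡⟨ cong (_* c) (∑-𝟙-≡ᵇ-toℕ t) ⟩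
  1 * c                                       ≡⟨ *-identityˡ c ⟩
  c                                           ∎
  where open ≡-Reasoning

∑-𝟙-pow2≤ : ∀ k {n} (P : Fin n → Bool) (φ : Fin n → ℕ) (ψ : ℕ → ℕ) →
  (∀ s → φ s < 2 ^ k) → (∀ s j → T (P s) → 2 ^ j ≡ φ s → toℕ s ≡ ψ j) →
  ∑[ s ∈ allFin n ] 𝟙 (P s ∧ isPow2 (φ s)) ≤ k
∑-𝟙-pow2≤ k {n} P φ ψ φ<2^k ψ-inverse = begin
  ∑[ s ∈ allFin n ] 𝟙 (P s ∧ isPow2 (φ s))              ≤⟨ ∑-mono-≤ (allFin n) pointwise ⟩
  ∑[ s ∈ allFin n ] ∑[ j ∈ upTo k ] 𝟙 (toℕ s ≡ᵇ ψ j)    ≡⟨ ∑-comm (allFin n) (upTo k) _ ⟩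
  ∑[ j ∈ upTo k ] ∑[ s ∈ allFin n ] 𝟙 (toℕ s ≡ᵇ ψ j)    ≤⟨ ∑-mono-≤ (upTo k) (λ j → ∑-𝟙-≡ᵇ≤1 n (ψ j)) ⟩
  ∑[ j ∈ upTo k ] 1                                     ≡⟨ ∑-const (upTo k) 1 ⟩
  length (upTo k) * 1                                   ≡⟨ *-identityʳ _ ⟩
  length (upTo k)                                       ≡⟨ length-upTo k ⟩
  k                                                     ∎
  where
  open ≤-Reasoning
  pointwise : ∀ s → 𝟙 (P s ∧ isPow2 (φ s)) ≤ ∑[ j ∈ upTo k ] 𝟙 (toℕ s ≡ᵇ ψ j)
  pointwise s = 𝟙-≤ λ Ps∧pow → let (Ps , pow) = Equivalence.to T-∧ Ps∧pow
                                   (j , 2^j≡φs) = isPow2-sound (φ s) pow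
                                   j<k = ≰⇒> λ k≤j → <⇒≱ (subst (_< 2 ^ k) (sym 2^j≡φs) (φ<2^k s)) (^-monoʳ-≤ 2 k≤j)
    in ≤-trans (T⇒1≤𝟙 (≡⇒≡ᵇ _ _ (ψ-inverse s j Ps 2^j≡φs)))
               (∈⇒≤∑ (λ j → 𝟙 (toℕ s ≡ᵇ ψ j)) (∈-upTo⁺ {k} j<k))

step : ∀ {n} → Fin n → Fin n → Bool
step s t = (toℕ s <ᵇ toℕ t) ∧ isPow2 (toℕ t ∸ toℕ s)

step-irrefl : ∀ {n} {s t : Fin n} → toℕ s ≡ toℕ t → step s t ≡ false
step-irrefl {t = t} s≡t rewrite s≡t | <ᵇ-irrefl (toℕ t) = refl

inDeg-step≤ : ∀ k (t : Fin (2 ^ k)) → inDeg (allFin (2 ^ k)) step t ≤ k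
inDeg-step≤ k t = ∑-𝟙-pow2≤ k {2 ^ k} (λ s → toℕ s <ᵇ toℕ t) (λ s → toℕ t ∸ toℕ s) (λ j → toℕ t ∸ 2 ^ j)
  (λ s → ≤-<-trans (m∸n≤m (toℕ t) (toℕ s)) (toℕ<n t))
  (λ s j s<t 2^j≡t∸s → trans (sym (m∸[m∸n]≡n (<⇒≤ (<ᵇ⇒< _ _ s<t)))) (cong (toℕ t ∸_) (sym 2^j≡t∸s)))

outDeg-step≤ : ∀ k (t : Fin (2 ^ k)) → outDeg (allFin (2 ^ k)) step t ≤ k
outDeg-step≤ k t = ∑-𝟙-pow2≤ k {2 ^ k} (λ s → toℕ t <ᵇ toℕ s) (λ s → toℕ s ∸ toℕ t) (λ j → toℕ t + 2 ^ j)
  (λ s → ≤-<-trans (m∸n≤m (toℕ s) (toℕ t)) (toℕ<n s))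
  (λ s j t<s 2^j≡s∸t → trans (sym (m+[n∸m]≡n (<⇒≤ (<ᵇ⇒< _ _ t<s)))) (cong (toℕ t +_) (sym 2^j≡s∸t)))

-- Coordinatewise equality, in the form isEdge produces once a differing coordinate is split off.
samePoint : ∀ {n d} → Point n d → Point n d → Bool
samePoint x y = (numDiff x y ≡ᵇ 0) ∧ coordOK x y

samePoint-∷ : ∀ {n d} (s t : Fin n) (x y : Point n d) →
              samePoint (s ∷ x) (t ∷ y) ≡ (toℕ s ≡ᵇ toℕ t) ∧ samePoint x y
samePoint-∷ s t x y with toℕ s ≡ᵇ toℕ t
... | true  = refl
... | false = refl

samePoint-sym : ∀ {n d} (x y : Point n d) → samePoint x y ≡ samePoint y x
samePoint-sym []      []      = refl
samePoint-sym (s ∷ x) (t ∷ y) = begin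
  samePoint (s ∷ x) (t ∷ y)            ≡⟨ samePoint-∷ s t x y ⟩
  (toℕ s ≡ᵇ toℕ t) ∧ samePoint x y     ≡⟨ cong₂ _∧_ (≡ᵇ-comm (toℕ s) (toℕ t)) (samePoint-sym x y) ⟩
  (toℕ t ≡ᵇ toℕ s) ∧ samePoint y x     ≡⟨ samePoint-∷ t s y x ⟨
  samePoint (t ∷ y) (s ∷ x)            ∎
  where open ≡-Reasoning

∑-samePoint : ∀ {n d} (x : Point n d) → ∑[ y ∈ allPoints n d ] 𝟙 (samePoint y x) ≡ 1
∑-samePoint             []      = refl
∑-samePoint {n} {suc d} (t ∷ x) = begin
  ∑[ y ∈ allPoints n (suc d) ] 𝟙 (samePoint y (t ∷ x))
    ≡⟨ ∑-allPoints-suc n d _ ⟩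
  ∑[ s ∈ allFin n ] ∑[ y ∈ pts ] 𝟙 (samePoint (s ∷ y) (t ∷ x))
    ≡⟨ ∑-cong (allFin n) (λ s → ∑-cong pts λ y → trans (cong 𝟙 (samePoint-∷ s t y x)) (𝟙-∧ (toℕ s ≡ᵇ toℕ t) _)) ⟩
  ∑[ s ∈ allFin n ] ∑[ y ∈ pts ] (𝟙 (toℕ s ≡ᵇ toℕ t) * 𝟙 (samePoint y x))
    ≡⟨ ∑-cong (allFin n) (λ s → *-distribˡ-∑ (𝟙 (toℕ s ≡ᵇ toℕ t)) pts (λ y → 𝟙 (samePoint y x))) ⟨
  ∑[ s ∈ allFin n ] (𝟙 (toℕ s ≡ᵇ toℕ t) * ∑[ y ∈ pts ] 𝟙 (samePoint y x))
    ≡⟨ ∑-𝟙-≡ᵇ-* t _ ⟩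
  ∑[ y ∈ pts ] 𝟙 (samePoint y x)
    ≡⟨ ∑-samePoint x ⟩
  1 ∎
  where
  open ≡-Reasoning
  pts = allPoints n d

isEdge-∷ : ∀ {n d} (s t : Fin n) (x y : Point n d) →
  𝟙 (isEdge (s ∷ x) (t ∷ y)) ≡ 𝟙 (toℕ s ≡ᵇ toℕ t) * 𝟙 (isEdge x y) + 𝟙 (step s t) * 𝟙 (samePoint x y)
isEdge-∷ s t x y with toℕ s ≡ᵇ toℕ t in s≡t
... | true  rewrite step-irrefl {s = s} {t} (≡ᵇ⇒≡ _ _ (subst T (sym s≡t) _)) =
  sym (trans (+-identityʳ _) (*-identityˡ _))
... | false = trans (cong 𝟙 (swap (numDiff x y ≡ᵇ 0) (step s t) (coordOK x y))) (𝟙-∧ (step s t) _)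
  where
  swap : ∀ a b c → a ∧ (b ∧ c) ≡ b ∧ (a ∧ c)
  swap a b c = trans (sym (∧-assoc a b c)) (trans (cong (_∧ c) (∧-comm a b)) (∧-assoc b a c))

∑-split-first : ∀ {n d} (t : Fin n) (w : Fin n → ℕ) (G H : Point n d → ℕ) → ∑ (allPoints n d) H ≡ 1 →
  ∑[ s ∈ allFin n ] ∑[ y ∈ allPoints n d ] (𝟙 (toℕ s ≡ᵇ toℕ t) * G y + w s * H y) ≡ ∑ (allFin n) w + ∑ (allPoints n d) G
∑-split-first {n} {d} t w G H ∑H≡1 = begin
  ∑[ s ∈ allFin n ] ∑[ y ∈ pts ] (𝟙 (toℕ s ≡ᵇ toℕ t) * G y + w s * H y)
    ≡⟨ ∑-cong (allFin n) (λ s → ∑-distrib-+ pts _ _) ⟩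
  ∑[ s ∈ allFin n ] (∑[ y ∈ pts ] (𝟙 (toℕ s ≡ᵇ toℕ t) * G y) + ∑[ y ∈ pts ] (w s * H y))
    ≡⟨ ∑-cong (allFin n) (λ s → cong₂ _+_ (*-distribˡ-∑ (𝟙 (toℕ s ≡ᵇ toℕ t)) pts G) (*-distribˡ-∑ (w s) pts H)) ⟨
  ∑[ s ∈ allFin n ] (𝟙 (toℕ s ≡ᵇ toℕ t) * ∑ pts G + w s * ∑ pts H)
    ≡⟨ ∑-cong (allFin n) (λ s → cong (λ h → 𝟙 (toℕ s ≡ᵇ toℕ t) * ∑ pts G + w s * h) ∑H≡1) ⟩
  ∑[ s ∈ allFin n ] (𝟙 (toℕ s ≡ᵇ toℕ t) * ∑ pts G + w s * 1)
    ≡⟨ ∑-distrib-+ (allFin n) _ _ ⟩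
  ∑[ s ∈ allFin n ] (𝟙 (toℕ s ≡ᵇ toℕ t) * ∑ pts G) + ∑[ s ∈ allFin n ] (w s * 1)
    ≡⟨ cong₂ _+_ (∑-𝟙-≡ᵇ-* t (∑ pts G)) (∑-cong (allFin n) (λ s → *-identityʳ (w s))) ⟩
  ∑ pts G + ∑ (allFin n) w
    ≡⟨ +-comm (∑ pts G) _ ⟩
  ∑ (allFin n) w + ∑ pts G
    ∎
  where
  open ≡-Reasoning
  pts = allPoints n d

outDeg-∷ : ∀ {n d} (t : Fin n) (x : Point n d) →
  outDeg (allPoints n (suc d)) isEdge (t ∷ x) ≡ outDeg (allFin n) step t + outDeg (allPoints n d) isEdge x
outDeg-∷ {n} {d} t x = begin
  ∑[ z ∈ allPoints n (suc d) ] 𝟙 (isEdge (t ∷ x) z)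
    ≡⟨ ∑-allPoints-suc n d _ ⟩
  ∑[ s ∈ allFin n ] ∑[ y ∈ pts ] 𝟙 (isEdge (t ∷ x) (s ∷ y))
    ≡⟨ ∑-cong (allFin n) (λ s → ∑-cong pts λ y → trans (isEdge-∷ t s x y)
         (cong₂ (λ a b → 𝟙 a * 𝟙 (isEdge x y) + 𝟙 (step t s) * 𝟙 b) (≡ᵇ-comm (toℕ t) (toℕ s)) (samePoint-sym x y))) ⟩
  ∑[ s ∈ allFin n ] ∑[ y ∈ pts ] (𝟙 (toℕ s ≡ᵇ toℕ t) * 𝟙 (isEdge x y) + 𝟙 (step t s) * 𝟙 (samePoint y x))
    ≡⟨ ∑-split-first t (λ s → 𝟙 (step t s)) (𝟙 ∘ isEdge x) (λ y → 𝟙 (samePoint y x)) (∑-samePoint x) ⟩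
  outDeg (allFin n) step t + outDeg pts isEdge x ∎
  where
  open ≡-Reasoning
  pts = allPoints n d

inDeg-∷ : ∀ {n d} (t : Fin n) (x : Point n d) →
  inDeg (allPoints n (suc d)) isEdge (t ∷ x) ≡ inDeg (allFin n) step t + inDeg (allPoints n d) isEdge x
inDeg-∷ {n} {d} t x = begin
  ∑[ z ∈ allPoints n (suc d) ] 𝟙 (isEdge z (t ∷ x))
    ≡⟨ ∑-allPoints-suc n d _ ⟩
  ∑[ s ∈ allFin n ] ∑[ y ∈ pts ] 𝟙 (isEdge (s ∷ y) (t ∷ x))
    ≡⟨ ∑-cong (allFin n) (λ s → ∑-cong pts (λ y → isEdge-∷ s t y x)) ⟩
  ∑[ s ∈ allFin n ] ∑[ y ∈ pts ] (𝟙 (toℕ s ≡ᵇ toℕ t) * 𝟙 (isEdge y x) + 𝟙 (step s t) * 𝟙 (samePoint y x))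
    ≡⟨ ∑-split-first t (λ s → 𝟙 (step s t)) (λ y → 𝟙 (isEdge y x)) (λ y → 𝟙 (samePoint y x)) (∑-samePoint x) ⟩
  inDeg (allFin n) step t + inDeg pts isEdge x ∎
  where
  open ≡-Reasoning
  pts = allPoints n d

outDeg≡∑ : ∀ {n d} (x : Point n d) → outDeg (allPoints n d) isEdge x ≡ ∑[ t ∈ toList x ] outDeg (allFin n) step t
outDeg≡∑ []      = refl
outDeg≡∑ (t ∷ x) = trans (outDeg-∷ t x) (cong (outDeg (allFin _) step t +_) (outDeg≡∑ x))

inDeg≡∑ : ∀ {n d} (x : Point n d) → inDeg (allPoints n d) isEdge x ≡ ∑[ t ∈ toList x ] inDeg (allFin n) step t
inDeg≡∑ []      = refl
inDeg≡∑ (t ∷ x) = trans (inDeg-∷ t x) (cong (inDeg (allFin _) step t +_) (inDeg≡∑ x))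

open import Data.Integer using (_⊖_; ∣_∣)

pos-∑ : ∀ (xs : List A) f → ℤ.+ ∑ xs f ≡ ℤSum.∑ xs (λ x → ℤ.+ f x)
pos-∑ []       f = refl
pos-∑ (x ∷ xs) f = trans (ℤ.pos-+ (f x) (∑ xs f)) (cong (ℤ._+_ (ℤ.+ f x)) (pos-∑ xs f))

⊖-distrib-+ : ∀ a b c d → (a + b) ⊖ (c + d) ≡ (a ⊖ c) ℤ.+ (b ⊖ d)
⊖-distrib-+ a b c d = begin
  (a + b) ⊖ (c + d)                                ≡⟨ ℤ.[+m]-[+n]≡m⊖n (a + b) (c + d) ⟨
  ℤ.+ (a + b) ℤ.- ℤ.+ (c + d)                      ≡⟨ cong₂ ℤ._-_ (ℤ.pos-+ a b) (ℤ.pos-+ c d) ⟩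
  (ℤ.+ a ℤ.+ ℤ.+ b) ℤ.- (ℤ.+ c ℤ.+ ℤ.+ d)          ≡⟨ interchange (ℤ.+ a) (ℤ.+ b) (ℤ.+ c) (ℤ.+ d) ⟩
  (ℤ.+ a ℤ.- ℤ.+ c) ℤ.+ (ℤ.+ b ℤ.- ℤ.+ d)          ≡⟨ cong₂ ℤ._+_ (ℤ.[+m]-[+n]≡m⊖n a c) (ℤ.[+m]-[+n]≡m⊖n b d) ⟩
  (a ⊖ c) ℤ.+ (b ⊖ d)                              ∎
  where
  open ≡-Reasoning
  interchange : ∀ a b c d → (a ℤ.+ b) ℤ.- (c ℤ.+ d) ≡ (a ℤ.- c) ℤ.+ (b ℤ.- d)
  interchange = ℤRing.solve-∀

∑-⊖ : ∀ (xs : List A) f g → ∑ xs f ⊖ ∑ xs g ≡ ℤSum.∑ xs (λ x → f x ⊖ g x)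
∑-⊖ []       f g = refl
∑-⊖ (x ∷ xs) f g = trans (⊖-distrib-+ (f x) (∑ xs f) (g x) (∑ xs g)) (cong (ℤ._+_ (f x ⊖ g x)) (∑-⊖ xs f g))

+∣i∣*∣i∣≡i*i : ∀ i → ℤ.+ (∣ i ∣ * ∣ i ∣) ≡ i ℤ.* i
+∣i∣*∣i∣≡i*i (ℤ.+ m)    = ℤ.pos-* m m
+∣i∣*∣i∣≡i*i ℤ.-[1+ m ] = refl

m∸n≤∣m⊖n∣ : ∀ m n → m ∸ n ≤ ∣ m ⊖ n ∣
m∸n≤∣m⊖n∣ m n with ≤-total m n
... | inj₁ m≤n = subst (_≤ ∣ m ⊖ n ∣) (sym (m≤n⇒m∸n≡0 m≤n)) z≤n
... | inj₂ n≤m = ≤-reflexive (sym (trans (ℤ.∣m⊖n∣≡∣n⊖m∣ m n) (ℤ.∣⊖∣-≤ n≤m)))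

open Variance using (coordSum; ∑-coordSum²)

∑-∣coordSum∣² : ∀ {n} (h : Fin n → ℤ) → ℤSum.∑ (allFin n) h ≡ ℤ.0ℤ → ∀ d →
  n * ∑[ x ∈ allPoints n d ] (∣ coordSum h x ∣ * ∣ coordSum h x ∣) ≡ d * n ^ d * ∑[ t ∈ allFin n ] (∣ h t ∣ * ∣ h t ∣)
∑-∣coordSum∣² {n} h ∑h≡0 d = ℤ.+-injective $ begin
  ℤ.+ (n * ∑[ x ∈ pts ] (∣ G x ∣ * ∣ G x ∣))
    ≡⟨ ℤ.pos-* n _ ⟩
  ℤ.+ n ℤ.* ℤ.+ ∑[ x ∈ pts ] (∣ G x ∣ * ∣ G x ∣)
    ≡⟨ cong (ℤ._*_ (ℤ.+ n)) (squares pts G) ⟩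
  ℤ.+ n ℤ.* ℤSum.∑ pts (λ x → G x ℤ.* G x)
    ≡⟨ ∑-coordSum² h ∑h≡0 d ⟩
  ℤ.+ d ℤ.* ℤ.+ (n ^ d) ℤ.* ℤSum.∑ (allFin n) (λ t → h t ℤ.* h t)
    ≡⟨ cong₂ ℤ._*_ (ℤ.pos-* d (n ^ d)) (squares (allFin n) h) ⟨
  ℤ.+ (d * n ^ d) ℤ.* ℤ.+ ∑[ t ∈ allFin n ] (∣ h t ∣ * ∣ h t ∣)
    ≡⟨ ℤ.pos-* (d * n ^ d) _ ⟨
  ℤ.+ (d * n ^ d * ∑[ t ∈ allFin n ] (∣ h t ∣ * ∣ h t ∣)) ∎
  where
  open ≡-Reasoning
  pts = allPoints n d
  G = coordSum h
  squares : ∀ (xs : List A) (g : A → ℤ) → ℤ.+ ∑[ x ∈ xs ] (∣ g x ∣ * ∣ g x ∣) ≡ ℤSum.∑ xs (λ x → g x ℤ.* g x)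
  squares xs g = trans (pos-∑ xs _) (ℤSum.∑-cong xs (λ x → +∣i∣*∣i∣≡i*i (g x)))

degDiff : ∀ {n} → Fin n → ℤ
degDiff {n} t = inDeg (allFin n) step t ⊖ outDeg (allFin n) step t

∑-degDiff≡0 : ∀ n → ℤSum.∑ (allFin n) degDiff ≡ ℤ.0ℤ
∑-degDiff≡0 n = begin
  ℤSum.∑ (allFin n) degDiff          ≡⟨ ∑-⊖ (allFin n) _ _ ⟨
  ∑ (allFin n) in₁ ⊖ ∑ (allFin n) out₁  ≡⟨ cong (_⊖ ∑ (allFin n) out₁) (Digraph.∑-inDeg≡∑-outDeg (allFin n) step) ⟩
  ∑ (allFin n) out₁ ⊖ ∑ (allFin n) out₁ ≡⟨ ℤ.n⊖n≡0 (∑ (allFin n) out₁) ⟩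
  ℤ.0ℤ                               ∎
  where
  open ≡-Reasoning
  in₁ out₁ : Fin n → ℕ
  in₁  = inDeg (allFin n) step
  out₁ = outDeg (allFin n) step

∣degDiff∣≤ : ∀ k (t : Fin (2 ^ k)) → ∣ degDiff t ∣ ≤ k
∣degDiff∣≤ k t = ≤-trans (ℤ.∣m⊝n∣≤m⊔n (inDeg (allFin (2 ^ k)) step t) (outDeg (allFin (2 ^ k)) step t))
                         (⊔-lub (inDeg-step≤ k t) (outDeg-step≤ k t))

gridDegDiff : ∀ {n d} (x : Point n d) →
  inDeg (allPoints n d) isEdge x ⊖ outDeg (allPoints n d) isEdge x ≡ coordSum degDiff x
gridDegDiff x = trans (cong₂ _⊖_ (inDeg≡∑ x) (outDeg≡∑ x)) (∑-⊖ (toList x) _ _)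

excess≤∑∣coordSum∣ : ∀ {n d} → excess (allPoints n d) isEdge ≤ ∑[ x ∈ allPoints n d ] ∣ coordSum degDiff x ∣
excess≤∑∣coordSum∣ {n} {d} = ∑-mono-≤ pts λ x →
  subst (λ i → inDeg pts isEdge x ∸ outDeg pts isEdge x ≤ ∣ i ∣) (gridDegDiff x)
        (m∸n≤∣m⊖n∣ (inDeg pts isEdge x) (outDeg pts isEdge x))
  where pts = allPoints n d

∑-∣degDiff∣²≤ : ∀ k → ∑[ t ∈ allFin (2 ^ k) ] (∣ degDiff t ∣ * ∣ degDiff t ∣) ≤ 2 ^ k * (k * k)
∑-∣degDiff∣²≤ k = begin
  ∑[ t ∈ allFin n ] (∣ degDiff t ∣ * ∣ degDiff t ∣)  ≤⟨ ∑-mono-≤ (allFin n) (λ t → *-mono-≤ (∣degDiff∣≤ k t) (∣degDiff∣≤ k t)) ⟩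
  ∑[ t ∈ allFin n ] (k * k)                          ≡⟨ ∑-const (allFin n) (k * k) ⟩
  length (allFin n) * (k * k)                        ≡⟨ cong (_* (k * k)) (length-tabulate {n = n} id) ⟩
  n * (k * k)                                        ∎
  where
  open ≤-Reasoning
  n = 2 ^ k

∑-∣coordSum-degDiff∣²≤ : ∀ k d → let n = 2 ^ k in
  ∑[ x ∈ allPoints n d ] (∣ coordSum degDiff x ∣ * ∣ coordSum degDiff x ∣) ≤ d * n ^ d * (k * k)
∑-∣coordSum-degDiff∣²≤ k d = *-cancelˡ-≤ n {{m^n≢0 2 k}} $ begin
  n * ∑[ x ∈ allPoints n d ] (∣ coordSum degDiff x ∣ * ∣ coordSum degDiff x ∣)
    ≡⟨ ∑-∣coordSum∣² degDiff (∑-degDiff≡0 n) d ⟩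
  d * n ^ d * ∑[ t ∈ allFin n ] (∣ degDiff t ∣ * ∣ degDiff t ∣)
    ≤⟨ *-monoʳ-≤ (d * n ^ d) (∑-∣degDiff∣²≤ k) ⟩
  d * n ^ d * (n * (k * k))
    ≡⟨ regroup (d * n ^ d) n (k * k) ⟩
  n * (d * n ^ d * (k * k))
    ∎
  where
  open ≤-Reasoning
  n = 2 ^ k
  regroup : ∀ a b c → a * (b * c) ≡ b * (a * c)
  regroup = solve-∀

excess²≤ : ∀ k d → excess (allPoints (2 ^ k) d) isEdge ^ 2 ≤ k ^ 2 * (d * ((2 ^ k) ^ d) ^ 2)
excess²≤ k d = begin
  excess pts isEdge ^ 2                        ≤⟨ ^-monoˡ-≤ 2 (excess≤∑∣coordSum∣ {n} {d}) ⟩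
  (∑ pts ∣G∣) ^ 2                              ≡⟨ cong (∑ pts ∣G∣ *_) (*-identityʳ _) ⟩
  ∑ pts ∣G∣ * ∑ pts ∣G∣                        ≤⟨ cauchy-schwarz pts ∣G∣ ⟩
  length pts * ∑[ x ∈ pts ] (∣G∣ x * ∣G∣ x)    ≤⟨ *-mono-≤ (≤-reflexive (length-allPoints n d)) (∑-∣coordSum-degDiff∣²≤ k d) ⟩
  N * (d * N * (k * k))                        ≡⟨ regroup N d k ⟩
  k ^ 2 * (d * N ^ 2)                          ∎
  where
  open ≤-Reasoning
  n = 2 ^ k
  N = n ^ d
  pts = allPoints n d
  ∣G∣ : Point n d → ℕ
  ∣G∣ x = ∣ coordSum degDiff x ∣
  regroup : ∀ N d k → N * (d * N * (k * k)) ≡ k * (k * 1) * (d * (N * (N * 1)))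
  regroup = solve-∀

[m+n]²≤2m²+2n² : ∀ m n → (m + n) ^ 2 ≤ 2 * m ^ 2 + 2 * n ^ 2
[m+n]²≤2m²+2n² m n = begin
  (m + n) ^ 2                          ≡⟨ expand m n ⟩
  m * m + n * n + 2 * (m * n)          ≤⟨ +-monoʳ-≤ (m * m + n * n) (2mn≤m²+n² m n) ⟩
  m * m + n * n + (m * m + n * n)      ≡⟨ regroup m n ⟩
  2 * m ^ 2 + 2 * n ^ 2                ∎
  where
  open ≤-Reasoning
  expand : ∀ m n → (m + n) * ((m + n) * 1) ≡ m * m + n * n + 2 * (m * n)
  expand = solve-∀
  regroup : ∀ m n → m * m + n * n + (m * m + n * n) ≡ 2 * (m * (m * 1)) + 2 * (n * (n * 1))
  regroup = solve-∀

square-bound : ∀ {s m e x k} → 1 ≤ k → s ≤ 2 * m + e → m ^ 2 < x → e ^ 2 ≤ k ^ 2 * x → s ^ 2 < 49 * k ^ 2 * x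
square-bound {s} {m} {e} {x} {k} 1≤k s≤2m+e m²<x e²≤k²x = begin-strict
  s ^ 2                                ≤⟨ ^-monoˡ-≤ 2 s≤2m+e ⟩
  (2 * m + e) ^ 2                      ≤⟨ [m+n]²≤2m²+2n² (2 * m) e ⟩
  2 * (2 * m) ^ 2 + 2 * e ^ 2          ≡⟨ cong (_+ 2 * e ^ 2) (eight m) ⟩
  8 * m ^ 2 + 2 * e ^ 2                ≤⟨ +-mono-≤ (*-monoʳ-≤ 8 (≤-trans (<⇒≤ m²<x) x≤k²x)) (*-monoʳ-≤ 2 e²≤k²x) ⟩
  8 * (k ^ 2 * x) + 2 * (k ^ 2 * x)    ≡⟨ *-distribʳ-+ (k ^ 2 * x) 8 2 ⟨
  10 * (k ^ 2 * x)                     <⟨ *-monoˡ-< (k ^ 2 * x) {{>-nonZero 0<k²x}} (m<m+n 10 {39} z<s) ⟩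
  49 * (k ^ 2 * x)                     ≡⟨ *-assoc 49 (k ^ 2) x ⟨
  49 * k ^ 2 * x                       ∎
  where
  open ≤-Reasoning
  eight : ∀ m → 2 * ((2 * m) * ((2 * m) * 1)) ≡ 8 * (m * (m * 1))
  eight = solve-∀
  x≤k²x : x ≤ k ^ 2 * x
  x≤k²x = ≤-trans (≤-reflexive (sym (*-identityˡ x))) (*-monoˡ-≤ x (^-monoˡ-≤ 2 1≤k))
  0<k²x : 0 < k ^ 2 * x
  0<k²x = <-≤-trans (≤-<-trans z≤n m²<x) x≤k²x

lemma5p1 : (k d : ℕ) → 1 ≤ k → (f : Point (2 ^ k) d → Bool) →
    sizeS⁻ f ^ 2 < d * ((2 ^ k) ^ d) ^ 2 →
    sizeS f ^ 2 < 49 * k ^ 2 * d * ((2 ^ k) ^ d) ^ 2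
lemma5p1 k d 1≤k f hyp =
  subst (sizeS f ^ 2 <_) (sym (*-assoc (49 * k ^ 2) d _)) $
  square-bound {m = sizeS⁻ f} {e = excess pts isEdge} 1≤k cut-bound hyp (excess²≤ k d)
  where
  pts = allPoints (2 ^ k) d
  cut-bound : sizeS f ≤ 2 * sizeS⁻ f + excess pts isEdge
  cut-bound = subst₂ (λ c m → c ≤ 2 * m + excess pts isEdge) (sym (sizeS≡cut f)) (sym (sizeS⁻≡descents f))
                     (cut≤2*descents+excess pts isEdge f)
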